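{- Let $G=(A\cup P,\mathcal{E})$ be an instance of the rank-maximal matching problem and $a_1\in A$, and suppose the preference list of $a_1$ contains a non-$f$-post; let $i$ be the rank of a highest ranked non-$f$-post in the preference list of $a_1$. If $a_1$ is not matched to a rank one post (i.e. some rank-maximal matching of $G$ does not match $a_1$ to a rank one post), then in any rank-maximal matching of $G$ in which $a_1$ is matched to a post that is not of rank one, that post has rank at least $i$ in $a_1$'s preference list.
   Context: An instance is a bipartite graph $G=(A\cup P,\mathcal{E})$ ($A$ = applicants, $P$ = posts) in which each edge $(a,p)$ has a positive integer rank describing $a$'s preference list (ties allowed; smaller rank = more preferred; "highest ranked" = smallest rank). Let $r$ be the largest rank. A matching is a set of edges no two sharing an endpoint. The signature of a matching $M$ is $(x_1,\dots,x_r)$ with $x_i$ the number of applicants matched in $M$ by a rank $i$ edge; a matching is rank-maximal if its signature is lexicographically largest among all matchings. $G_1$ denotes the subgraph of $G$ consisting of the rank one edges. For a bipartite graph $K$ with a maximum matching $M$, a vertex is even (resp. odd) if it is reachable from some vertex unmatched in $M$ by an $M$-alternating path of even (resp. odd) length, and unreachable otherwise; the sets $E(K),O(K),U(K)$ do not depend on the choice of $M$. A post is an $f$-post (with respect to $a_1$) if it belongs to $O(K)\cup U(K)$, where $K$ is obtained from $G_1$ by deleting $a_1$; all other posts are non-$f$-posts. -}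

module Defs where

open import Data.Nat using (ℕ; zero; suc; _+_; _≤_; _<_; _⊔_)
open import Data.Nat.Divisibility using (_∣_)
open import Data.Bool using (if_then_else_)
open import Data.Fin using (Fin)
open import Data.List using (List; []; _∷_; length; map; foldr; allFin; last; concatMap)
open import Data.Nat.ListAction using (sum)
open import Data.List.Relation.Unary.Unique.Propositional using (Unique)
open import Data.Maybe using (Maybe; just; nothing)
open import Data.Sum using (_⊎_; inj₁; inj₂)
open import Data.Product using (_×_; Σ; ∃; ∃-syntax)
open import Data.Unit using (⊤)
open import Data.Empty using (⊥)
open import Data.Bool using (Bool; true; false; not)
open import Relation.Nullary using (¬_; Dec; yes; no)
open import Relation.Binary.PropositionalEquality using (_≡_; _≢_)

-- An instance: applicants Fin nA, posts Fin nP, and a rank function.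
-- rank a p ≡ 0  means (a,p) is NOT an edge;
-- rank a p ≡ k ≥ 1 means (a,p) is an edge of rank k.
-- (Ties are allowed: several posts may have the same rank for a.)

record Instance : Set where
  field
    nA nP : ℕ
    rank  : Fin nA → Fin nP → ℕ

module _ (G : Instance) where
  open Instance G

  IsEdge : Fin nA → Fin nP → Set
  IsEdge a p = 1 ≤ rank a p

  maxRank : ℕ
  maxRank = foldr _⊔_ 0 (concatMap (λ a → map (rank a) (allFin nP)) (allFin nA))

  record IsMatchingOf (E : Fin nA → Fin nP → Set) (M : Fin nA → Maybe (Fin nP)) : Set where
    field
      edges : ∀ a p → M a ≡ just p → E a p
      inj   : ∀ a b p → M a ≡ just p → M b ≡ just p → a ≡ b

  IsMatching : (Fin nA → Maybe (Fin nP)) → Set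
  IsMatching = IsMatchingOf IsEdge

  matchedRank : (Fin nA → Maybe (Fin nP)) → ℕ → Fin nA → ℕ
  matchedRank M k a with M a
  ... | nothing = 0
  ... | just p with rank a p Data.Nat.≟ k
  ...   | yes _ = 1
  ...   | no  _ = 0

  sig : (Fin nA → Maybe (Fin nP)) → ℕ → ℕ
  sig M k = sum (map (matchedRank M k) (allFin nA))

  LexGreater : (N M : Fin nA → Maybe (Fin nP)) → Set
  LexGreater N M = ∃[ k ] (1 ≤ k × k ≤ maxRank × sig M k < sig N k
                            × (∀ j → 1 ≤ j → j < k → sig N j ≡ sig M j))

  RankMaximal : (Fin nA → Maybe (Fin nP)) → Set
  RankMaximal M = IsMatching M × (∀ N → IsMatching N → ¬ LexGreater N M)

  -- The graph K = G₁ with applicant a₁ deleted, and even/odd/unreachable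
  -- vertices with respect to a maximum matching of K.

  module WithA₁ (a₁ : Fin nA) where

    KEdge : Fin nA → Fin nP → Set
    KEdge a p = a ≢ a₁ × rank a p ≡ 1

    -- matchings of K (a₁ is not a vertex of K, hence unmatched)
    IsKMatching : (Fin nA → Maybe (Fin nP)) → Set
    IsKMatching M = IsMatchingOf KEdge M × M a₁ ≡ nothing

    isMatched : (Fin nA → Maybe (Fin nP)) → Fin nA → ℕ
    isMatched M a with M a
    ... | nothing = 0
    ... | just _  = 1

    size : (Fin nA → Maybe (Fin nP)) → ℕ
    size M = sum (map (isMatched M) (allFin nA))

    IsMaxKMatching : (Fin nA → Maybe (Fin nP)) → Set
    IsMaxKMatching M = IsKMatching M × (∀ N → IsKMatching N → size N ≤ size M)

    V : Set
    V = Fin nA ⊎ Fin nP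

    InK : V → Set
    InK (inj₁ a) = a ≢ a₁
    InK (inj₂ p) = ⊤

    Adj : V → V → Set
    Adj (inj₁ a) (inj₂ p) = KEdge a p
    Adj (inj₂ p) (inj₁ a) = KEdge a p
    Adj _ _ = ⊥

    module WithM (M : Fin nA → Maybe (Fin nP)) where

      InM : V → V → Set
      InM (inj₁ a) (inj₂ p) = M a ≡ just p
      InM (inj₂ p) (inj₁ a) = M a ≡ just p
      InM _ _ = ⊥

      Free : V → Set
      Free (inj₁ a) = a ≢ a₁ × M a ≡ nothing
      Free (inj₂ p) = ∀ a → M a ≢ just p

      AltChain : Bool → List V → Set
      AltChain b [] = ⊤
      AltChain b (v ∷ []) = ⊤
      AltChain b (u ∷ v ∷ vs) =
        Adj u v × (if b then InM u v else ¬ InM u v) × AltChain (not b) (v ∷ vs)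

      record AltPathFromFree (v : V) (ℓ : ℕ) : Set where
        field
          u     : V
          rest  : List V
          free  : Free u
          uniq  : Unique (u ∷ rest)
          alt   : AltChain false (u ∷ rest)
          ends  : last (u ∷ rest) ≡ just v
          len   : length rest ≡ ℓ

      Even : V → Set
      Even v = ∃[ ℓ ] (AltPathFromFree v ℓ × 2 ∣ ℓ)

      Odd : V → Set
      Odd v = ∃[ ℓ ] (AltPathFromFree v ℓ × ¬ (2 ∣ ℓ))

      Unreachable : V → Set
      Unreachable v = ¬ Even v × ¬ Odd v

      FPost : Fin nP → Set
      FPost p = Odd (inj₂ p) ⊎ Unreachable (inj₂ p)

      NonFPost : Fin nP → Set
      NonFPost p = ¬ FPost p

-- Lemma 5: if a₁ is M-matched, in a rank-maximal matching M, to a post p of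
-- rank other than one, then p is a non-f-post, so the rank of p is at least the
-- rank i of a highest ranked non-f-post.  Fix a maximum matching M₁ of K = G₁ − a₁.
--
-- p is even.  Follow M₁ backwards and rank one M-edges forwards,
--   p ←M₁− x₁ −M→ q₁ ←M₁− x₂ −M→ q₂ ← … ,
-- a simple M₁-alternating path in K (the "chain").  If some xₖ had no rank one
-- M-edge, re-matching xₖ and the chain's applicants by M₁ and unmatching a₁ would
-- give more rank one edges than M; so the chain grows until it ends at an
-- M₁-free post, and read backwards it is an even alternating path to p.
-- p is not odd.  An odd alternating path to p starts at an M₁-free applicant;
-- following it to its first post on the chain and then the chain to its free end
-- gives an M₁-augmenting path in K, contradicting the maximality of M₁.
--
-- Both contradictions are instances of one swap lemma: overriding a matching N
-- by a matching T that is closed under N (every N-partner of a post used by T is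
-- T-matched) gives a matching.
module Submission where

open import Defs
open import Data.Nat using (ℕ; _≤_; _<_; _+_; _⊔_; zero; suc; s≤s; z≤n; _≟_)
open import Data.Nat.Properties
  using (≤-refl; ≤-trans; <⇒≱; ≤-reflexive; +-mono-≤; +-mono-<-≤; +-mono-≤-<; m≤m⊔n; m≤n⊔m; n≤1+n; +-suc; +-comm)
open import Data.Nat.Divisibility using (_∣_; divides)
open import Data.Nat.ListAction using (sum)
open import Data.Fin using (Fin) renaming (_≟_ to _≟ᶠ_)
open import Data.Fin.Properties using (any?)
open import Data.Maybe using (Maybe; just; nothing; _<∣>_)
open import Data.Maybe.Properties using (just-injective)
import Data.Maybe.Properties as Maybe
open import Data.Product using (_×_; ∃-syntax; _,_; proj₁; proj₂; Σ)
open import Data.Sum using (_⊎_; inj₁; inj₂)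
import Data.Sum.Properties as Sum
open import Data.List using (List; []; _∷_; length; map; foldr; allFin; last; _++_)
open import Data.List.Properties using (length-map; length-++; length-tabulate)
open import Data.List.Membership.Propositional using (_∈_; _∉_)
open import Data.List.Membership.Propositional.Properties using (∈-allFin; ∈-map⁺; ∈-concatMap⁺; ∈-++⁺ˡ; ∈-++⁺ʳ)
open import Data.List.Relation.Binary.Subset.Propositional using (_⊆_)
open import Data.List.Relation.Unary.Any as Any using (here; there)
import Data.List.Relation.Unary.All as All
open import Data.List.Relation.Unary.All.Properties.Core using (¬Any⇒All¬)
open import Data.List.Relation.Unary.Unique.Propositional using (Unique)
open import Data.List.Relation.Unary.AllPairs using (_∷_; [])
open import Data.Empty using (⊥; ⊥-elim)
open import Data.Unit using (tt)
open import Data.Bool using (false)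
open import Relation.Nullary using (¬_; Dec; yes; no; ¬?)
open import Relation.Binary.PropositionalEquality

sum-mono : {A : Set} (f g : A → ℕ) (xs : List A) →
           (∀ x → f x ≤ g x) → sum (map f xs) ≤ sum (map g xs)
sum-mono f g []       f≤g = z≤n
sum-mono f g (x ∷ xs) f≤g = +-mono-≤ (f≤g x) (sum-mono f g xs f≤g)

sum-strict : {A : Set} (f g : A → ℕ) (xs : List A) {s : A} →
             (∀ x → f x ≤ g x) → s ∈ xs → f s < g s → sum (map f xs) < sum (map g xs)
sum-strict f g (x ∷ xs) f≤g (here refl) fs<gs = +-mono-<-≤ fs<gs (sum-mono f g xs f≤g)
sum-strict f g (x ∷ xs) f≤g (there s∈) fs<gs = +-mono-≤-< (f≤g x) (sum-strict f g xs f≤g s∈ fs<gs)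

≤-maximum : ∀ {n} (ns : List ℕ) → n ∈ ns → n ≤ foldr _⊔_ 0 ns
≤-maximum (m ∷ ms) (here refl) = m≤m⊔n m _
≤-maximum (m ∷ ms) (there n∈) = ≤-trans (≤-maximum ms n∈) (m≤n⊔m m _)

delete : {A : Set} {x : A} (ys : List A) → x ∈ ys →
         Σ (List A) λ zs → length ys ≡ suc (length zs) × (∀ {z} → z ∈ ys → z ≢ x → z ∈ zs)
delete (y ∷ ys) (here refl) = ys , refl , λ { (here refl) z≢y → ⊥-elim (z≢y refl) ; (there z∈) _ → z∈ }
delete (y ∷ ys) (there x∈) with delete ys x∈
... | zs , len , keep = y ∷ zs , cong suc len
                      , λ { (here refl) _ → here refl ; (there z∈) z≢x → there (keep z∈ z≢x) }

unique-length : {A : Set} (xs ys : List A) → Unique xs → xs ⊆ ys → length xs ≤ length ys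
unique-length []       ys _               _     = z≤n
unique-length (x ∷ xs) ys (x∉xs ∷ unique) xs⊆ys with delete ys (xs⊆ys (here refl))
... | zs , len , keep = subst (suc (length xs) ≤_) (sym len)
  (s≤s (unique-length xs zs unique λ z∈xs → keep (xs⊆ys (there z∈xs)) λ { refl → All.lookup x∉xs z∈xs refl }))

last-∈ : {A : Set} (xs : List A) {v : A} → last xs ≡ just v → v ∈ xs
last-∈ (x ∷ [])     refl = here refl
last-∈ (x ∷ y ∷ ys) eq   = there (last-∈ (y ∷ ys) eq)

Defined : {B : Set} → Maybe B → Set
Defined m = ∃[ b ] m ≡ just b

nothing≢just : {B : Set} {b : B} → nothing ≢ just b
nothing≢just ()

_◁_ : {A B : Set} → (A → Maybe B) → (A → Maybe B) → A → Maybe B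
(T ◁ N) x = T x <∣> N x

update : ∀ {n} {B : Set} → (Fin n → Maybe B) → Fin n → B → Fin n → Maybe B
update T x b z with z ≟ᶠ x
... | yes _ = just b
... | no  _ = T z

update-here : ∀ {n} {B : Set} (T : Fin n → Maybe B) x b → update T x b x ≡ just b
update-here T x b with x ≟ᶠ x
... | yes _   = refl
... | no  x≢x = ⊥-elim (x≢x refl)

update-cases : ∀ {n} {B : Set} (T : Fin n → Maybe B) x b {z c} →
               update T x b z ≡ just c → (z ≡ x × c ≡ b) ⊎ T z ≡ just c
update-cases T x b {z} eq with z ≟ᶠ x
... | yes z≡x = inj₁ (z≡x , sym (just-injective eq))
... | no  _   = inj₂ eq

update-defined : ∀ {n} {B : Set} (T : Fin n → Maybe B) x b {z} →
                 z ≡ x ⊎ Defined (T z) → Defined (update T x b z)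
update-defined T x b {z} cases with z ≟ᶠ x | cases
... | yes _   | _          = b , refl
... | no  z≢x | inj₁ z≡x   = ⊥-elim (z≢x z≡x)
... | no  _   | inj₂ def   = def

restrict : {A B : Set} {P : A → Set} → (∀ x → Dec (P x)) → (A → Maybe B) → A → Maybe B
restrict P? N z with P? z
... | yes _ = N z
... | no  _ = nothing

restrict-just : ∀ {A B : Set} {P : A → Set} (P? : ∀ x → Dec (P x)) (N : A → Maybe B) {z b} →
                restrict P? N z ≡ just b → P z × N z ≡ just b
restrict-just P? N {z} eq with P? z
... | yes Pz = Pz , eq

restrict-inside : ∀ {A B : Set} {P : A → Set} (P? : ∀ x → Dec (P x)) (N : A → Maybe B) {z} →
                  P z → restrict P? N z ≡ N z
restrict-inside P? N {z} Pz with P? z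
... | yes _   = refl
... | no ¬Pz = ⊥-elim (¬Pz Pz)

module Matchings (G : Instance) where
  open Instance G

  Assignment : Set
  Assignment = Fin nA → Maybe (Fin nP)

  Closed : Assignment → Assignment → Set
  Closed T N = ∀ x y {t} → T x ≡ just t → N y ≡ just t → Defined (T y)

  module _ {E : Fin nA → Fin nP → Set} where

    override-matching : {T N : Assignment} → IsMatchingOf G E T → IsMatchingOf G E N →
                        Closed T N → IsMatchingOf G E (T ◁ N)
    override-matching {T} {N} mT mN closed = record { edges = edges ; inj = inj }
      where
      module T = IsMatchingOf mT
      module N = IsMatchingOf mN
      clash : ∀ {x y t} → T x ≡ just t → T y ≡ nothing → N y ≡ just t → ⊥
      clash {x} {y} Tx Ty Ny with closed x y Tx Ny
      ... | _ , Ty′ = nothing≢just (trans (sym Ty) Ty′)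
      edges : ∀ x t → (T ◁ N) x ≡ just t → E x t
      edges x t eq with T x in Tx
      ... | just _  = T.edges x t (trans Tx eq)
      ... | nothing = N.edges x t eq
      inj : ∀ x y t → (T ◁ N) x ≡ just t → (T ◁ N) y ≡ just t → x ≡ y
      inj x y t eqx eqy with T x in Tx | T y in Ty
      ... | just _  | just _  = T.inj x y t (trans Tx eqx) (trans Ty eqy)
      ... | just _  | nothing = ⊥-elim (clash (trans Tx eqx) Ty eqy)
      ... | nothing | just _  = ⊥-elim (clash (trans Ty eqy) Tx eqx)
      ... | nothing | nothing = N.inj x y t eqx eqy

    update-matching : {T : Assignment} {x : Fin nA} {t : Fin nP} → IsMatchingOf G E T →
                      E x t → (∀ z → T z ≢ just t) → IsMatchingOf G E (update T x t)
    update-matching {T} {x} {t} mT e fresh = record { edges = edges ; inj = inj }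
      where
      module T = IsMatchingOf mT
      edges : ∀ z s → update T x t z ≡ just s → E z s
      edges z s eq with update-cases T x t {z} eq
      ... | inj₁ (refl , refl) = e
      ... | inj₂ Tz            = T.edges z s Tz
      inj : ∀ z₁ z₂ s → update T x t z₁ ≡ just s → update T x t z₂ ≡ just s → z₁ ≡ z₂
      inj z₁ z₂ s eq₁ eq₂ with update-cases T x t {z₁} eq₁ | update-cases T x t {z₂} eq₂
      ... | inj₁ (refl , _)    | inj₁ (refl , _)    = refl
      ... | inj₁ (_ , refl)    | inj₂ Tz₂           = ⊥-elim (fresh z₂ Tz₂)
      ... | inj₂ Tz₁           | inj₁ (_ , refl)    = ⊥-elim (fresh z₁ Tz₁)
      ... | inj₂ Tz₁           | inj₂ Tz₂           = T.inj z₁ z₂ s Tz₁ Tz₂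

    restrict-matching : {P : Fin nA → Set} (P? : ∀ x → Dec (P x)) {N : Assignment} →
                        IsMatchingOf G E N → IsMatchingOf G E (restrict P? N)
    restrict-matching P? {N} mN = record
      { edges = λ x t eq → N.edges x t (proj₂ (restrict-just P? N eq))
      ; inj   = λ x y t eqx eqy → N.inj x y t (proj₂ (restrict-just P? N eqx)) (proj₂ (restrict-just P? N eqy)) }
      where module N = IsMatchingOf mN

  weaken : {E E′ : Fin nA → Fin nP → Set} {N : Assignment} →
           (∀ {x t} → E x t → E′ x t) → IsMatchingOf G E N → IsMatchingOf G E′ N
  weaken E⇒E′ mN = record
    { edges = λ x t eq → E⇒E′ (IsMatchingOf.edges mN x t eq) ; inj = IsMatchingOf.inj mN }

  matchedRank-≤1 : ∀ N k x → matchedRank G N k x ≤ 1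
  matchedRank-≤1 N k x with N x
  ... | nothing = z≤n
  ... | just t with rank x t ≟ k
  ...   | yes _ = ≤-refl
  ...   | no  _ = z≤n

  matchedRank-hit : ∀ N k {x t} → N x ≡ just t → rank x t ≡ k → matchedRank G N k x ≡ 1
  matchedRank-hit N k {x} {t} Nx r rewrite Nx with rank x t ≟ k
  ... | yes _ = refl
  ... | no r≢k = ⊥-elim (r≢k r)

  matchedRank-miss : ∀ N k {x} → (∀ {t} → N x ≡ just t → rank x t ≢ k) → matchedRank G N k x ≡ 0
  matchedRank-miss N k {x} miss with N x
  ... | nothing = refl
  ... | just t with rank x t ≟ k
  ...   | yes r = ⊥-elim (miss refl r)
  ...   | no  _ = refl

  matchedRank-witness : ∀ N k x → 0 < matchedRank G N k x → ∃[ t ] (N x ≡ just t × rank x t ≡ k)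
  matchedRank-witness N k x pos with N x
  ... | just t with rank x t ≟ k
  ...   | yes r = t , refl , r

  matchedRank-◁ : ∀ T N k → (∀ {x t} → T x ≡ just t → rank x t ≡ k) →
                  ∀ x → matchedRank G N k x ≤ matchedRank G (T ◁ N) k x
  matchedRank-◁ T N k rank-k x with T x in Tx
  ... | just t  = subst (matchedRank G N k x ≤_)
                    (sym (matchedRank-hit (λ _ → just t) k refl (rank-k Tx)))
                    (matchedRank-≤1 N k x)
  ... | nothing = ≤-refl

  matchedRank-restrict : ∀ {P : Fin nA → Set} (P? : ∀ z → Dec (P z)) N k z →
                         (¬ P z → matchedRank G N k z ≡ 0) → matchedRank G N k z ≤ matchedRank G (restrict P? N) k z
  matchedRank-restrict P? N k z outside with P? z
  ... | yes _   = ≤-refl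
  ... | no  ¬Pz = subst (_≤ 0) (sym (outside ¬Pz)) z≤n

  rank≤maxRank : ∀ x t → rank x t ≤ maxRank G
  rank≤maxRank x t = ≤-maximum _ (∈-concatMap⁺ (λ a → map (rank a) (allFin nP))
    (Any.map (λ { refl → ∈-map⁺ (rank x) (∈-allFin t) }) (∈-allFin x)))

  rankOne-gain : ∀ M N {s} → (∀ x → matchedRank G M 1 x ≤ matchedRank G N 1 x) →
                 matchedRank G M 1 s < matchedRank G N 1 s → LexGreater G N M
  rankOne-gain M N {s} M≤N Ms<Ns = 1 , ≤-refl , 1≤maxRank
    , sum-strict _ _ (allFin nA) M≤N (∈-allFin s) Ms<Ns , λ j 1≤j j<1 → ⊥-elim (<⇒≱ j<1 1≤j)
    where
    1≤maxRank : 1 ≤ maxRank G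
    1≤maxRank with matchedRank-witness N 1 s (≤-trans (s≤s z≤n) Ms<Ns)
    ... | t , _ , r = subst (_≤ maxRank G) r (rank≤maxRank s t)

  other? : (a : Fin nA) → ∀ z → Dec (z ≢ a)
  other? a z = ¬? (z ≟ᶠ a)

  _without_ : Assignment → Fin nA → Assignment
  N without a = restrict (other? a) N

  no-rankOne-swap : ∀ {M T a p x t} → RankMaximal G M → M a ≡ just p → rank a p ≢ 1 →
                    IsMatchingOf G (λ z s → rank z s ≡ 1) T → Closed T (M without a) →
                    (∀ {s} → M x ≡ just s → rank x s ≢ 1) → T x ≡ just t → ⊥
  no-rankOne-swap {M} {T} {a} {p} {x} {t} (mM , maximal) Ma a-not-rank-one mT closed x-not-rank-one Tx =
    maximal N (override-matching (weaken (λ r → ≤-reflexive (sym r)) mT) (restrict-matching (other? a) mM) closed)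
      (rankOne-gain M N pointwise strict)
    where
    N : Assignment
    N = T ◁ (M without a)
    rankOne-not-a : ∀ {z s} → M z ≡ just s → rank z s ≡ 1 → z ≢ a
    rankOne-not-a Mz r refl = a-not-rank-one (subst (λ s → rank a s ≡ 1) (just-injective (trans (sym Mz) Ma)) r)
    -- unmatching a loses no rank one edge, and T only adds rank one edges
    pointwise : ∀ z → matchedRank G M 1 z ≤ matchedRank G N 1 z
    pointwise z = ≤-trans
      (matchedRank-restrict (other? a) M 1 z λ ¬z≢a → matchedRank-miss M 1 λ Mz r → ¬z≢a (rankOne-not-a Mz r))
      (matchedRank-◁ T (M without a) 1 (λ {z} {s} Tz → IsMatchingOf.edges mT z s Tz) z)
    strict : matchedRank G M 1 x < matchedRank G N 1 x
    strict = subst₂ _<_ (sym (matchedRank-miss M 1 x-not-rank-one))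
      (sym (matchedRank-hit N 1 (cong (_<∣> (M without a) x) Tx) (IsMatchingOf.edges mT x t Tx))) (s≤s z≤n)

module Alternating (G : Instance) (a₁ : Fin (Instance.nA G)) where
  open Instance G
  open WithA₁ G a₁
  open Matchings G

  isMatched-≤1 : ∀ N x → isMatched N x ≤ 1
  isMatched-≤1 N x with N x
  ... | nothing = z≤n
  ... | just _  = ≤-refl

  isMatched-◁ : ∀ T N x → isMatched N x ≤ isMatched (T ◁ N) x
  isMatched-◁ T N x with T x
  ... | just _  = isMatched-≤1 N x
  ... | nothing = ≤-refl

  no-augmenting-swap : ∀ {M₁ T : Assignment} → IsMaxKMatching M₁ → IsMatchingOf G KEdge T →
                       Closed T M₁ → ∀ {u} → M₁ u ≡ nothing → Defined (T u) → ⊥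
  no-augmenting-swap {M₁} {T} ((mM₁ , M₁a₁) , maximum) mT closed {u} M₁u (t , Tu) =
    <⇒≱ larger (maximum (T ◁ M₁) (override-matching mT mM₁ closed , unmatched-a₁))
    where
    unmatched-a₁ : (T ◁ M₁) a₁ ≡ nothing
    unmatched-a₁ with T a₁ in Ta₁
    ... | just s  = ⊥-elim (proj₁ (IsMatchingOf.edges mT a₁ s Ta₁) refl)
    ... | nothing = M₁a₁
    gain : isMatched M₁ u < isMatched (T ◁ M₁) u
    gain rewrite M₁u | Tu = s≤s z≤n
    larger : size M₁ < size (T ◁ M₁)
    larger = sum-strict _ _ (allFin nA) (isMatched-◁ T M₁) (∈-allFin u) gain

  vertices : List V
  vertices = map inj₁ (allFin nA) ++ map inj₂ (allFin nP)

  simple-path-length : (vs : List V) → Unique vs → length vs ≤ nA + nP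
  simple-path-length vs unique = ≤-trans (unique-length vs vertices unique (λ _ → complete))
                                         (≤-reflexive count)
    where
    complete : ∀ {v} → v ∈ vertices
    complete {inj₁ x} = ∈-++⁺ˡ (∈-map⁺ inj₁ (∈-allFin x))
    complete {inj₂ y} = ∈-++⁺ʳ (map inj₁ (allFin nA)) (∈-map⁺ inj₂ (∈-allFin y))
    count : length vertices ≡ nA + nP
    count = trans (length-++ (map inj₁ (allFin nA)))
      (cong₂ _+_ (trans (length-map inj₁ (allFin nA)) (length-tabulate {n = nA} (λ x → x)))
                 (trans (length-map inj₂ (allFin nP)) (length-tabulate {n = nP} (λ x → x))))

  -- K is bipartite, so an alternating walk between two posts has even length.
  module Parity (N : Assignment) where
    open WithM N

    post-to-post : ∀ {b y w} vs → AltChain b (inj₂ y ∷ vs) → last (inj₂ y ∷ vs) ≡ just (inj₂ w) →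
                   2 ∣ length vs
    applicant-to-post : ∀ {b x w} vs → AltChain b (inj₁ x ∷ vs) → last (inj₁ x ∷ vs) ≡ just (inj₂ w) →
                        2 ∣ suc (length vs)
    post-to-post []             _            _   = divides 0 refl
    post-to-post (inj₁ x ∷ vs) (_ , _ , alt) end = applicant-to-post vs alt end
    post-to-post (inj₂ _ ∷ vs) (() , _)      _
    applicant-to-post (inj₂ y ∷ vs) (_ , _ , alt) end with post-to-post vs alt end
    ... | divides k eq = divides (suc k) (cong (λ n → suc (suc n)) eq)
    applicant-to-post (inj₁ _ ∷ vs) (() , _) _

module PartnerOfA₁ (G : Instance) (a₁ : Fin (Instance.nA G))
  (M₁ : Fin (Instance.nA G) → Maybe (Fin (Instance.nP G)))
  (M₁-max : WithA₁.IsMaxKMatching G a₁ M₁)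
  (M : Fin (Instance.nA G) → Maybe (Fin (Instance.nP G))) (M-rm : RankMaximal G M)
  (p : Fin (Instance.nP G)) (Mp : M a₁ ≡ just p) (p-not-rank-one : Instance.rank G a₁ p ≢ 1) where

  open Instance G
  open WithA₁ G a₁
  open WithM M₁
  open Matchings G
  open Alternating G a₁

  open import Data.List.Membership.DecPropositional (Sum.≡-dec (_≟ᶠ_ {nA}) (_≟ᶠ_ {nP})) using (_∈?_)

  M₁-edge : ∀ {x t} → M₁ x ≡ just t → KEdge x t
  M₁-edge {x} {t} = IsMatchingOf.edges (proj₁ (proj₁ M₁-max)) x t

  M₁-inj : ∀ {x y t} → M₁ x ≡ just t → M₁ y ≡ just t → x ≡ y
  M₁-inj {x} {y} {t} = IsMatchingOf.inj (proj₁ (proj₁ M₁-max)) x y t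

  M-inj : ∀ {x y t} → M x ≡ just t → M y ≡ just t → x ≡ y
  M-inj {x} {y} {t} = IsMatchingOf.inj (proj₁ M-rm) x y t

  RankOneInM : Fin nA → Fin nP → Set
  RankOneInM x t = M x ≡ just t × rank x t ≡ 1

  rankOne? : ∀ x → Dec (∃[ t ] RankOneInM x t)
  rankOne? x with M x
  ... | nothing = no λ { (_ , () , _) }
  ... | just t with rank x t ≟ 1
  ...   | yes r   = yes (t , refl , r)
  ...   | no  r≢1 = no λ { (_ , refl , r) → r≢1 r }

  -- Rank one M-edges lie in K, because the M-edge of a₁ does not have rank one.
  rankOne⇒KEdge : ∀ {x t} → RankOneInM x t → KEdge x t
  rankOne⇒KEdge (Mx , r) =
    (λ { refl → p-not-rank-one (subst (λ s → rank a₁ s ≡ 1) (just-injective (trans (sym Mx) Mp)) r) }) , r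

  -- A chain ending at q:  q ←M− x −M₁→ … ←M− x₁ −M₁→ p,  alternately a rank one
  -- M-edge and an M₁-edge, read from q back to p.
  data Chain : Fin nP → Set where
    start  : Chain p
    extend : ∀ {q q′} → Chain q → (x : Fin nA) → M₁ x ≡ just q → RankOneInM x q′ → Chain q′

  trail : ∀ {q} → Chain q → List V
  trail start                = []
  trail (extend {q} c x _ _) = inj₁ x ∷ inj₂ q ∷ trail c

  path : ∀ {q} → Chain q → List V
  path {q} c = inj₂ q ∷ trail c

  trail-applicant : ∀ {q z} (c : Chain q) → inj₁ z ∈ trail c → ∃[ y ] (M₁ z ≡ just y × inj₂ y ∈ trail c)
  trail-applicant (extend {q} c x e _) (here refl)         = q , e , there (here refl)
  trail-applicant (extend c x _ _)     (there (here ()))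
  trail-applicant (extend c x _ _)     (there (there z∈)) with trail-applicant c z∈
  ... | y , e , y∈ = y , e , there (there y∈)

  chain-post : ∀ {q y} (c : Chain q) → inj₂ y ∈ path c → y ≡ p ⊎ ∃[ z ] (inj₁ z ∈ trail c × RankOneInM z y)
  chain-post start              (here refl)         = inj₁ refl
  chain-post (extend c x _ r)   (here refl)         = inj₂ (x , here refl , r)
  chain-post (extend c x _ _)   (there (here ()))
  chain-post (extend c x _ _)   (there (there y∈)) with chain-post c y∈
  ... | inj₁ y≡p             = inj₁ y≡p
  ... | inj₂ (z , z∈ , r)    = inj₂ (z , there (there z∈) , r)

  path-unique : ∀ {q} (c : Chain q) → Unique (path c)
  fresh-applicant : ∀ {q x} (c : Chain q) → M₁ x ≡ just q → inj₁ x ∉ path c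
  fresh-post : ∀ {q q′ x} (c : Chain q) → M₁ x ≡ just q → RankOneInM x q′ → inj₂ q′ ∉ path c

  path-unique start = All.[] ∷ []
  path-unique (extend c x e r) =
    ¬Any⇒All¬ _ (λ { (here ()) ; (there q′∈) → fresh-post c e r q′∈ })
    ∷ ¬Any⇒All¬ _ (fresh-applicant c e) ∷ path-unique c

  fresh-applicant c e (here ())
  fresh-applicant c e (there x∈) with trail-applicant c x∈ | path-unique c
  ... | y , e′ , y∈ | q∉trail ∷ _ = All.lookup q∉trail y∈ (cong inj₂ (just-injective (trans (sym e) e′)))

  fresh-post c e (Mx , _) q′∈ with chain-post c q′∈
  ... | inj₁ refl = proj₁ (M₁-edge e) (M-inj Mx Mp)
  ... | inj₂ (z , z∈ , Mz , _) with M-inj Mz Mx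
  ...   | refl = fresh-applicant c e (there z∈)

  path-alternating : ∀ {q} (c : Chain q) → AltChain false (path c)
  path-alternating start = tt
  path-alternating (extend c x e r) =
    rankOne⇒KEdge r , (λ e′ → fresh-post c e r (here (cong inj₂ (just-injective (trans (sym e′) e)))))
    , M₁-edge e , e , path-alternating c

  path-ends : ∀ {q} (c : Chain q) → last (path c) ≡ just (inj₂ p)
  path-ends start            = refl
  path-ends (extend c x e r) = path-ends c

  trail-even : ∀ {q} (c : Chain q) → 2 ∣ length (trail c)
  trail-even start = divides 0 refl
  trail-even (extend c x e r) with trail-even c
  ... | divides k eq = divides (suc k) (cong (λ n → suc (suc n)) eq)

  -- A chain cannot stop at an applicant without a rank one M-edge: re-matching
  -- that applicant and those of the chain by M₁, and unmatching a₁, would give a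
  -- matching with more rank one edges than the rank-maximal M.
  chain-extends : ∀ {q x} (c : Chain q) → M₁ x ≡ just q → ∃[ t ] RankOneInM x t
  chain-extends {q} {x} c e with rankOne? x
  ... | yes r    = r
  ... | no  none = ⊥-elim (no-rankOne-swap M-rm Mp p-not-rank-one
      (restrict-matching InChain? (weaken proj₂ (proj₁ (proj₁ M₁-max)))) closed
      (λ Mx r → none (_ , Mx , r)) (trans (restrict-inside InChain? M₁ (here refl)) e))
    where
    InChain : Fin nA → Set
    InChain z = inj₁ z ∈ inj₁ x ∷ trail c
    InChain? : ∀ z → Dec (InChain z)
    InChain? z = inj₁ z ∈? inj₁ x ∷ trail c
    T : Assignment
    T = restrict InChain? M₁
    -- T only uses posts of the chain …
    on-chain : ∀ {z t} → InChain z → M₁ z ≡ just t → inj₂ t ∈ path c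
    on-chain (here refl) M₁z = here (cong inj₂ (just-injective (trans (sym M₁z) e)))
    on-chain (there z∈) M₁z with trail-applicant c z∈
    ... | _ , e′ , t∈ = there (subst (λ s → inj₂ s ∈ trail c) (just-injective (trans (sym e′) M₁z)) t∈)
    -- … whose M-partners other than a₁ lie on the chain and are M₁-matched
    closed : Closed T (M without a₁)
    closed z y Tz M⁻y with restrict-just InChain? M₁ {z} Tz | restrict-just (other? a₁) M {y} M⁻y
    ... | z∈ , M₁z | y≢a₁ , My with chain-post c (on-chain z∈ M₁z)
    ...   | inj₁ refl = ⊥-elim (y≢a₁ (M-inj My Mp))
    ...   | inj₂ (z′ , z′∈ , Mz′ , _) with M-inj My Mz′
    ...     | refl with trail-applicant c z′∈
    ...       | s , M₁y , _ = s , trans (restrict-inside InChain? M₁ (there z′∈)) M₁y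

  record CompleteChain : Set where
    field
      {end} : Fin nP
      chain : Chain end
      free  : ∀ x → M₁ x ≢ just end

  -- Extend the chain from p until its end is M₁-free; the fuel suffices because
  -- chains are simple paths.
  complete : ∀ {q} (fuel : ℕ) (c : Chain q) → nA + nP < fuel + length (path c) → CompleteChain
  complete zero        c too-long = ⊥-elim (<⇒≱ too-long (simple-path-length (path c) (path-unique c)))
  complete {q} (suc fuel) c too-long with any? (λ x → Maybe.≡-dec _≟ᶠ_ (M₁ x) (just q))
  ... | no unmatched = record { chain = c ; free = λ x e → unmatched (x , e) }
  ... | yes (x , e) with chain-extends c e
  ...   | _ , r = complete fuel (extend c x e r) (≤-trans too-long two-more)
    where
    two-more : suc fuel + length (path c) ≤ fuel + suc (suc (length (path c)))
    two-more = ≤-trans (n≤1+n _) (≤-reflexive (sym (trans (+-suc fuel _) (cong suc (+-suc fuel _)))))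

  complete-chain : CompleteChain
  complete-chain = complete (nA + nP) start (≤-reflexive (sym (+-comm (nA + nP) 1)))

  open CompleteChain complete-chain

  p-even : Even (inj₂ p)
  p-even = length (trail chain)
         , record { u = inj₂ end ; rest = trail chain ; free = free ; uniq = path-unique chain
                  ; alt = path-alternating chain ; ends = path-ends chain ; len = refl }
         , trail-even chain

  -- shift c y re-matches each applicant of c between its end and the post y to
  -- its rank one M-partner: the flip of the chain segment from its end to y.
  shift : ∀ {q} → Chain q → Fin nP → Assignment
  shift start y = λ _ → nothing
  shift (extend {q′ = q′} c x _ _) y with y ≟ᶠ q′
  ... | yes _ = λ _ → nothing
  ... | no  _ = update (shift c y) x q′

  shift-extend : ∀ {q q′ x y} (c : Chain q) (e : M₁ x ≡ just q) (r : RankOneInM x q′) → y ≢ q′ →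
                 ∀ z → shift (extend c x e r) y z ≡ update (shift c y) x q′ z
  shift-extend {q′ = q′} {y = y} c e r y≢q′ z with y ≟ᶠ q′
  ... | yes y≡q′ = ⊥-elim (y≢q′ y≡q′)
  ... | no  _    = refl

  shift-used : ∀ {q q′ x y z t} (c : Chain q) (e : M₁ x ≡ just q) (r : RankOneInM x q′) →
               shift (extend c x e r) y z ≡ just t → y ≢ q′
  shift-used {q′ = q′} {y = y} c e r eq y≡q′ with y ≟ᶠ q′
  ... | yes _   = nothing≢just eq
  ... | no y≢q′ = y≢q′ y≡q′

  shift-cases : ∀ {q q′ x y z t} (c : Chain q) (e : M₁ x ≡ just q) (r : RankOneInM x q′) →
                shift (extend c x e r) y z ≡ just t → (z ≡ x × t ≡ q′) ⊎ shift c y z ≡ just t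
  shift-cases {x = x} {y} {z} c e r eq =
    update-cases (shift c y) x _ {z} (trans (sym (shift-extend c e r (shift-used c e r eq) z)) eq)

  shift-defined : ∀ {q q′ x y z} (c : Chain q) (e : M₁ x ≡ just q) (r : RankOneInM x q′) → y ≢ q′ →
                  z ≡ x ⊎ Defined (shift c y z) → Defined (shift (extend c x e r) y z)
  shift-defined {q′ = q′} {x} {y} {z} c e r y≢q′ cases =
    subst Defined (sym (shift-extend c e r y≢q′ z)) (update-defined (shift c y) x q′ cases)

  shift-rankOne : ∀ {q y z t} (c : Chain q) → shift c y z ≡ just t → RankOneInM z t
  shift-rankOne {y = y} {z} (extend c x e r) eq with shift-cases {y = y} {z} c e r eq
  ... | inj₁ (refl , refl) = r
  ... | inj₂ shifted       = shift-rankOne c shifted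

  shift-matching : ∀ {q} (c : Chain q) y → IsMatchingOf G KEdge (shift c y)
  shift-matching c y = record
    { edges = λ z t eq → rankOne⇒KEdge (shift-rankOne c eq)
    ; inj   = λ z₁ z₂ t eq₁ eq₂ → M-inj (proj₁ (shift-rankOne c eq₁)) (proj₁ (shift-rankOne c eq₂)) }

  shift-image : ∀ {q y z t} (c : Chain q) → shift c y z ≡ just t → inj₂ t ∈ path c × t ≢ y
  shift-image {y = y} {z} (extend c x e r) eq with shift-cases {y = y} {z} c e r eq
  ... | inj₁ (_ , refl) = here refl , λ { refl → shift-used {y = y} {z} c e r eq refl }
  ... | inj₂ shifted with shift-image c shifted
  ...   | t∈ , t≢y = there (there t∈) , t≢y

  shift-closed : ∀ {q y z z′ t} (c : Chain q) → shift c y z ≡ just t → M₁ z′ ≡ just t →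
                 t ≡ q ⊎ Defined (shift c y z′)
  shift-closed {y = y} {z} {z′} {t} (extend {q} c x e r) eq M₁z′ with shift-cases {y = y} {z} c e r eq
  ... | inj₁ (_ , refl) = inj₁ refl
  ... | inj₂ shifted = inj₂ (shift-defined {y = y} {z′} c e r (shift-used {y = y} {z} c e r eq)
                                (re-matched (shift-closed c shifted M₁z′)))
    where
    re-matched : t ≡ q ⊎ Defined (shift c y z′) → z′ ≡ x ⊎ Defined (shift c y z′)
    re-matched (inj₁ refl) = inj₁ (M₁-inj M₁z′ e)
    re-matched (inj₂ def)  = inj₂ def

  shift-meets : ∀ {q y z′} (c : Chain q) → inj₂ y ∈ path c → M₁ z′ ≡ just y →
                y ≡ q ⊎ Defined (shift c y z′)
  shift-meets start            (here refl)       _ = inj₁ refl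
  shift-meets (extend c x e r) (here refl)       _ = inj₁ refl
  shift-meets (extend c x e r) (there (here ())) _
  shift-meets {y = y} (extend {q′ = q′} c x e r) (there (there y∈)) M₁z′ with y ≟ᶠ q′
  ... | yes y≡q′ = inj₁ y≡q′
  ... | no  y≢q′ with shift-meets c y∈ M₁z′
  ...   | inj₁ refl = inj₂ (update-defined (shift c y) x q′ (inj₁ (M₁-inj M₁z′ e)))
  ...   | inj₂ def  = inj₂ (update-defined (shift c y) x q′ (inj₂ def))

  -- A flip of an alternating path x, ys towards p, continued along the complete
  -- chain: a K-matching closed under M₁ that matches x and uses posts of ys or of
  -- the chain.
  record Flip (x : Fin nA) (ys : List V) : Set where
    field
      T        : Assignment
      matching : IsMatchingOf G KEdge T
      closed   : Closed T M₁
      covers   : Defined (T x)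
      images   : ∀ z {t} → T z ≡ just t → inj₂ t ∈ ys ⊎ inj₂ t ∈ path chain

  -- The end of the complete chain is M₁-free, so the flip of the chain from y on
  -- is closed under M₁ once x is matched to y.
  flip-into-chain : ∀ x y ys → KEdge x y → inj₂ y ∈ path chain → Flip x (inj₂ y ∷ ys)
  flip-into-chain x y ys xy y∈ = record
    { T = T ; matching = update-matching (shift-matching chain y) xy (λ z eq → proj₂ (shift-image chain eq) refl)
    ; closed = closed ; covers = _ , update-here S x y ; images = images }
    where
    S T : Assignment
    S = shift chain y
    T = update S x y
    closed : Closed T M₁
    closed z z′ Tz M₁z′ with update-cases S x y {z} Tz
    ... | inj₁ (_ , refl) with shift-meets chain y∈ M₁z′
    ...   | inj₁ refl = ⊥-elim (free z′ M₁z′)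
    ...   | inj₂ def  = update-defined S x y (inj₂ def)
    closed z z′ Tz M₁z′ | inj₂ Sz with shift-closed chain Sz M₁z′
    ...   | inj₁ refl = ⊥-elim (free z′ M₁z′)
    ...   | inj₂ def  = update-defined S x y (inj₂ def)
    images : ∀ z {t} → T z ≡ just t → inj₂ t ∈ inj₂ y ∷ ys ⊎ inj₂ t ∈ path chain
    images z Tz with update-cases S x y {z} Tz
    ... | inj₁ (_ , refl) = inj₁ (here refl)
    ... | inj₂ Sz         = inj₂ (proj₁ (shift-image chain Sz))

  -- Away from the chain, match x to y and flip the rest of the path, which
  -- re-matches the M₁-partner x′ of y.
  flip-along-path : ∀ x y x′ ys → KEdge x y → inj₂ y ∉ path chain → M₁ x′ ≡ just y →
                    inj₂ y ∉ ys → Flip x′ ys → Flip x (inj₂ y ∷ inj₁ x′ ∷ ys)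
  flip-along-path x y x′ ys xy y∉chain M₁x′ y∉ys rest = record
    { T = T ; matching = update-matching R.matching xy unused
    ; closed = closed ; covers = _ , update-here R.T x y ; images = images }
    where
    module R = Flip rest
    T : Assignment
    T = update R.T x y
    unused : ∀ z → R.T z ≢ just y
    unused z Rz with R.images z Rz
    ... | inj₁ y∈ys   = y∉ys y∈ys
    ... | inj₂ y∈chain = y∉chain y∈chain
    closed : Closed T M₁
    closed z z′ Tz M₁z′ with update-cases R.T x y {z} Tz
    ... | inj₁ (_ , refl) = update-defined R.T x y (inj₂ (subst (λ w → Defined (R.T w)) (M₁-inj M₁x′ M₁z′) R.covers))
    ... | inj₂ Rz         = update-defined R.T x y (inj₂ (R.closed z z′ Rz M₁z′))
    images : ∀ z {t} → T z ≡ just t → inj₂ t ∈ inj₂ y ∷ inj₁ x′ ∷ ys ⊎ inj₂ t ∈ path chain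
    images z Tz with update-cases R.T x y {z} Tz
    ... | inj₁ (_ , refl) = inj₁ (here refl)
    ... | inj₂ Rz with R.images z Rz
    ...   | inj₁ t∈ys   = inj₁ (there (there t∈ys))
    ...   | inj₂ t∈chain = inj₂ t∈chain

  -- Every alternating path from an applicant to p can be flipped, since p lies on
  -- the chain.
  flip : ∀ x ys → AltChain false (inj₁ x ∷ ys) → Unique (inj₁ x ∷ ys) →
         last (inj₁ x ∷ ys) ≡ just (inj₂ p) → Flip x ys
  flip x (inj₁ _ ∷ _) (() , _) _ _
  flip x (inj₂ y ∷ ys) (xy , _ , alt) (_ ∷ unique) end with inj₂ y ∈? path chain
  ... | yes y∈chain = flip-into-chain x y ys xy y∈chain
  flip x (inj₂ y ∷ []) _ _ end | no y∉chain =
    ⊥-elim (y∉chain (subst (_∈ path chain) (sym (just-injective end)) (last-∈ (path chain) (path-ends chain))))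
  flip x (inj₂ y ∷ inj₂ _ ∷ ys) (_ , _ , () , _) _ _ | no _
  flip x (inj₂ y ∷ inj₁ x′ ∷ ys) (xy , _ , _ , M₁x′ , alt) (_ ∷ (y∉ ∷ unique)) end | no y∉chain =
    flip-along-path x y x′ ys xy y∉chain M₁x′ (λ y∈ys → All.lookup y∉ (there y∈ys) refl)
      (flip x′ ys alt unique end)

  -- p is not odd: an odd alternating path to p starts at a free applicant, and
  -- flipping it augments M₁.
  p-not-odd : ¬ Odd (inj₂ p)
  p-not-odd (ℓ , odd-path , ℓ-odd) = from-start P.u P.free P.alt P.uniq P.ends
    where
    module P = AltPathFromFree odd-path
    open Alternating.Parity G a₁ M₁
    from-start : ∀ v → Free v → AltChain false (v ∷ P.rest) → Unique (v ∷ P.rest) →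
                 last (v ∷ P.rest) ≡ just (inj₂ p) → ⊥
    from-start (inj₂ w) _ alt _ end = ℓ-odd (subst (2 ∣_) P.len (post-to-post P.rest alt end))
    from-start (inj₁ x) (_ , M₁x) alt unique end =
      no-augmenting-swap M₁-max F.matching F.closed M₁x F.covers
      where module F = Flip (flip x P.rest alt unique end)

lemma5 : (G : Instance) (a₁ : Fin (Instance.nA G))
    → (M₁ : Fin (Instance.nA G) → Maybe (Fin (Instance.nP G)))
    → WithA₁.IsMaxKMatching G a₁ M₁
    → (i : ℕ)
    → (∃[ p ] (WithA₁.WithM.NonFPost G a₁ M₁ p × IsEdge G a₁ p × Instance.rank G a₁ p ≡ i))
    → (∀ p → WithA₁.WithM.NonFPost G a₁ M₁ p → IsEdge G a₁ p → i ≤ Instance.rank G a₁ p)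
    → (∃[ M' ] (RankMaximal G M' × ¬ (∃[ p ] (M' a₁ ≡ just p × Instance.rank G a₁ p ≡ 1))))
    → ∀ M → RankMaximal G M → ∀ p → M a₁ ≡ just p → Instance.rank G a₁ p ≢ 1
    → i ≤ Instance.rank G a₁ p
lemma5 G a₁ M₁ M₁-max i _ i-minimal _ M M-rm p Mp p-not-rank-one =
  i-minimal p p-non-f (IsMatchingOf.edges (proj₁ M-rm) a₁ p Mp)
  where
  open PartnerOfA₁ G a₁ M₁ M₁-max M M-rm p Mp p-not-rank-one using (p-even; p-not-odd)
  p-non-f : WithA₁.WithM.NonFPost G a₁ M₁ p
  p-non-f (inj₁ odd)             = p-not-odd odd
  p-non-f (inj₂ (not-even , _)) = not-even p-even
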